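{- Let $G_n$ be a caterpillar graph with central path $P_n=v_1v_2\cdots v_n$ such that for every $v_i\in V(P_n)$ either $l(v_i)\ge 2$ or $l(v_i)=0$. Let $P(0)$ denote the number of $0$-leaf segment paths of $P_n$. Then $$\lambda_H(G_n)=P(0)+\sum_{1\le i\le n,\ l(v_i)\ge 2}\bigl(l(v_i)-1\bigr).$$
   Context: A caterpillar graph $G_n$ is a tree containing a path $P_n$ on $n$ vertices (its central path) such that every vertex of $G_n$ is at distance at most $1$ from $P_n$; every vertex of $G_n$ not on $P_n$ is a leaf adjacent to a vertex of $P_n$. For a vertex $v$, $l(v)$ denotes the number of leaves adjacent to $v$. A $(0,1)$-leaf segment path of $P_n$ is a subpath $w_1w_2\cdots w_t$ of $P_n$ with $3\le t\le n$ such that $l(w_1)\ge 2$, $l(w_t)\ge 2$, and $l(w_i)\in\{0,1\}$ for all intermediate vertices $w_i$, $i\in[2,t-1]$. A $0$-leaf segment path is a $(0,1)$-leaf segment path whose intermediate vertices are adjacent to no leaf; $P(0)$ is the number of such subpaths of $P_n$. For a graph $G$, the Hamiltonian complete number $\lambda_H(G)$ is the minimum number of edges not in $E(G)$, joining vertices of $G$, whose addition to $G$ produces a graph containing a Hamiltonian (spanning) cycle. -}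

module Defs where

open import Data.Nat using (ℕ; zero; suc; _+_; _∸_; _≤_; _<_; _≤?_; _<?_; _≟_)
open import Data.Fin using (Fin; toℕ; inject₁; fromℕ)
open import Data.Fin.Properties using (all?)
open import Data.List using (List; length; map; filter; allFin; cartesianProduct)
open import Data.Nat.ListAction using (sum)
open import Data.List.Membership.Propositional using (_∈_)
open import Data.List.Relation.Unary.AllPairs using (AllPairs)
open import Data.List.Relation.Unary.All using (All)
open import Data.Product using (Σ; ∃; _×_; _,_; proj₁; proj₂)
open import Data.Sum using (_⊎_)
open import Data.Bool using (if_then_else_)
open import Relation.Nullary using (¬_; Dec; does)
open import Relation.Nullary.Decidable using (_×-dec_; _→-dec_)
open import Relation.Binary.PropositionalEquality using (_≡_; _≢_)
open import Function.Definitions using (Injective)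

-- The caterpillar G_n determined by its central path v_0 … v_{n-1}
-- (indices Fin n, v_i ↔ paper's v_{i+1}) and the leaf counts l(v_i).

data Vtx (n : ℕ) (l : Fin n → ℕ) : Set where
  spine : Fin n → Vtx n l
  leaf  : (i : Fin n) → Fin (l i) → Vtx n l

data Adj {n : ℕ} {l : Fin n → ℕ} : Vtx n l → Vtx n l → Set where
  path→ : ∀ {i j} → suc (toℕ i) ≡ toℕ j → Adj (spine i) (spine j)
  path← : ∀ {i j} → suc (toℕ j) ≡ toℕ i → Adj (spine i) (spine j)
  sp-lf : ∀ {i} (k : Fin (l i)) → Adj (spine i) (leaf i k)
  lf-sp : ∀ {i} (k : Fin (l i)) → Adj (leaf i k) (spine i)

SamePair : {V : Set} → V × V → V × V → Set
SamePair (a , b) (c , d) = ((a ≡ c) × (b ≡ d)) ⊎ ((a ≡ d) × (b ≡ c))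

ValidAddition : {V : Set} → (V → V → Set) → List (V × V) → Set
ValidAddition E F =
  All (λ e → (proj₁ e ≢ proj₂ e) × ¬ E (proj₁ e) (proj₂ e)) F
  × AllPairs (λ e f → ¬ SamePair e f) F

AddEdges : {V : Set} → (V → V → Set) → List (V × V) → V → V → Set
AddEdges E F u v = E u v ⊎ ((u , v) ∈ F) ⊎ ((v , u) ∈ F)

HasHamiltonianCycle : {V : Set} → (V → V → Set) → Set
HasHamiltonianCycle {V} H =
  Σ ℕ λ m → (2 ≤ m) × Σ (Fin (suc m) → V) λ c →
    Injective _≡_ _≡_ c
    × (∀ v → ∃ λ i → c i ≡ v)
    × (∀ (i : Fin m) → H (c (inject₁ i)) (c (Fin.suc i)))
    × H (c (fromℕ m)) (c Fin.zero)
  where import Data.Fin as Fin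

HamCompleteNumberIs : {V : Set} → (V → V → Set) → ℕ → Set
HamCompleteNumberIs E k =
  (Σ _ λ F → ValidAddition E F × length F ≡ k × HasHamiltonianCycle (AddEdges E F))
  × (∀ F → ValidAddition E F → HasHamiltonianCycle (AddEdges E F) → k ≤ length F)

ZeroLeafSegment : {n : ℕ} → (Fin n → ℕ) → Fin n → Fin n → Set
ZeroLeafSegment l i j =
  (toℕ i + 2 ≤ toℕ j) × (2 ≤ l i) × (2 ≤ l j)
  × (∀ k → toℕ i < toℕ k → toℕ k < toℕ j → l k ≡ 0)

zeroLeafSegment? : {n : ℕ} (l : Fin n → ℕ) (p : Fin n × Fin n) →
                   Dec (ZeroLeafSegment l (proj₁ p) (proj₂ p))
zeroLeafSegment? l (i , j) =
  (toℕ i + 2 ≤? toℕ j) ×-dec (2 ≤? l i) ×-dec (2 ≤? l j)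
  ×-dec all? (λ k → (toℕ i <? toℕ k) →-dec ((toℕ k <? toℕ j) →-dec (l k ≟ 0)))

P0 : {n : ℕ} → (Fin n → ℕ) → ℕ
P0 {n} l = length (filter (zeroLeafSegment? l) (cartesianProduct (allFin n) (allFin n)))

leafExcess : {n : ℕ} → (Fin n → ℕ) → ℕ
leafExcess {n} l = sum (map (λ i → if does (2 ≤? l i) then l i ∸ 1 else 0) (allFin n))

-- Let s be the successor map of a Hamiltonian cycle of G + F. A vertex v with s v not
-- adjacent to v in G is followed along an added edge, and since s is injective without
-- 2-cycles distinct such "bad" vertices use distinct added edges; so |F| is at least the
-- number of bad vertices. Conversely, any listing of the vertices is completed to a
-- Hamiltonian cycle by adding its non-adjacent consecutive pairs, one per bad vertex.
-- In the caterpillar, s injective means at most one leaf of v_i is followed by v_i, and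
-- none when a spine neighbour is; a leafless spine vertex is bad unless followed by a
-- spine neighbour. This gives l(v_i) - 1 bad leaves at each leafy v_i, and a left-to-right
-- scan of the spine finds one further bad vertex for every 0-leaf segment. Listing each
-- v_i between its first and its other leaves, in spine order, attains the bound: its bad
-- vertices are the leaves after the first at each leafy v_i and the last inner vertex of
-- each 0-leaf segment.

module Submission where

open import Defs
import Data.Nat as ℕ
open import Data.Nat using (ℕ; zero; suc; _+_; _∸_; _≤_; _<_; _<?_; z≤n; s≤s; s≤s⁻¹)
open import Data.Nat.Properties hiding (_≟_)
open import Algebra.Properties.CommutativeSemigroup +-commutativeSemigroup
  using (x∙yz≈y∙xz; xy∙z≈xz∙y; interchange)
open import Data.Fin as Fin using (Fin; zero; suc; toℕ; fromℕ; fromℕ<; inject₁)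
import Data.Fin.Properties as Finₚ
open import Data.List
  using (List; []; _∷_; _++_; length; map; filter; concat; allFin; tabulate; lookup; cartesianProduct)
import Data.List.Properties as Listₚ
open import Data.List.Membership.Propositional using (_∈_)
open import Data.List.Membership.Propositional.Properties
  using (∈-filter⁺; ∈-filter⁻; ∈-lookup; ∈-map⁺; ∈-map⁻; ∈-allFin; ∈-tabulate⁺; ∈-tabulate⁻; ∈-concat⁺′)
open import Data.List.Relation.Unary.Any as Any using (here; there)
open import Data.List.Relation.Unary.Any.Properties using (lookup-index)
open import Data.List.Relation.Unary.All as All using (All; []; _∷_)
import Data.List.Relation.Unary.All.Properties as Allₚ
open import Data.List.Relation.Unary.AllPairs as AllPairs using (AllPairs; []; _∷_)
import Data.List.Relation.Unary.AllPairs.Properties as AllPairsₚ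
open import Data.List.Relation.Unary.Unique.Propositional using (Unique)
import Data.List.Relation.Unary.Unique.Propositional.Properties as Uniqueₚ
open import Data.Nat.ListAction using (sum)
open import Data.Product using (Σ; ∃; ∃₂; _×_; _,_; proj₁; proj₂)
open import Data.Sum using (_⊎_; inj₁; inj₂)
open import Data.Bool using (true; false; if_then_else_)
open import Function using (_∘_)
open import Relation.Binary.Definitions using (tri<; tri≈; tri>)
open import Function.Definitions using (Injective)
open import Relation.Nullary using (¬_; Dec; yes; no; does; ¬?; contradiction)
open import Relation.Nullary.Decidable using (_×-dec_; dec-true; dec-false)
open import Data.Nat.Tactic.RingSolver using (solve-∀)
open import Relation.Unary using (Decidable)
open import Relation.Binary.PropositionalEquality
  using (_≡_; _≢_; refl; sym; trans; cong; cong₂; subst; module ≡-Reasoning)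

⟦_⟧ : {A : Set} → Dec A → ℕ
⟦ a? ⟧ = if does a? then 1 else 0

⟦⟧-yes : {A : Set} (a? : Dec A) → A → ⟦ a? ⟧ ≡ 1
⟦⟧-yes (yes _) _ = refl
⟦⟧-yes (no ¬a) a = contradiction a ¬a

⟦⟧-no : {A : Set} (a? : Dec A) → ¬ A → ⟦ a? ⟧ ≡ 0
⟦⟧-no (yes a) ¬a = contradiction a ¬a
⟦⟧-no (no _)  _  = refl

⟦⟧≤ : ∀ {A : Set} {n} (a? : Dec A) → (A → 1 ≤ n) → ⟦ a? ⟧ ≤ n
⟦⟧≤ (yes a) 1≤n = 1≤n a
⟦⟧≤ (no _)  _   = z≤n

∑< : ℕ → (ℕ → ℕ) → ℕ
∑< zero    f = 0
∑< (suc n) f = ∑< n f + f n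

syntax ∑< n (λ k → e) = ∑[ k < n ] e

∑-mono-≤ : ∀ n {f g : ℕ → ℕ} → (∀ k → k < n → f k ≤ g k) → ∑< n f ≤ ∑< n g
∑-mono-≤ zero    f≤g = z≤n
∑-mono-≤ (suc n) f≤g = +-mono-≤ (∑-mono-≤ n λ k k<n → f≤g k (m<n⇒m<1+n k<n)) (f≤g n ≤-refl)

∑-cong : ∀ n {f g : ℕ → ℕ} → (∀ k → k < n → f k ≡ g k) → ∑< n f ≡ ∑< n g
∑-cong zero    f≗g = refl
∑-cong (suc n) f≗g = cong₂ _+_ (∑-cong n λ k k<n → f≗g k (m<n⇒m<1+n k<n)) (f≗g n ≤-refl)

∑-distrib-+ : ∀ n (f g : ℕ → ℕ) → ∑[ k < n ] (f k + g k) ≡ ∑< n f + ∑< n g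
∑-distrib-+ zero    f g = refl
∑-distrib-+ (suc n) f g =
  trans (cong (_+ (f n + g n)) (∑-distrib-+ n f g)) (interchange (∑< n f) (∑< n g) (f n) (g n))

∑-unshift : ∀ n (f : ℕ → ℕ) → ∑[ k < suc n ] f k ≡ f 0 + ∑[ k < n ] f (suc k)
∑-unshift zero    f = +-comm 0 (f 0)
∑-unshift (suc n) f = trans (cong (_+ f (suc n)) (∑-unshift n f)) (+-assoc (f 0) _ _)

sum-tabulate : ∀ n {f : Fin n → ℕ} (F : ℕ → ℕ) → (∀ i → f i ≡ F (toℕ i)) →
               sum (tabulate f) ≡ ∑< n F
sum-tabulate zero    F f≗F = refl
sum-tabulate (suc n) F f≗F =
  trans (cong₂ _+_ (f≗F zero) (sum-tabulate n (F ∘ suc) (f≗F ∘ suc))) (sym (∑-unshift n F))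

-- Extension by 0 outside Fin n, so that spine neighbours can be named by ℕ arithmetic.
extend : ∀ {n} → (Fin n → ℕ) → ℕ → ℕ
extend {n} f k with k <? n
... | yes k<n = f (fromℕ< k<n)
... | no  _   = 0

extend-toℕ : ∀ {n} (f : Fin n → ℕ) (i : Fin n) → extend f (toℕ i) ≡ f i
extend-toℕ {n} f i with toℕ i <? n
... | yes i<n = cong f (Finₚ.fromℕ<-toℕ i i<n)
... | no  i≮n = contradiction (Finₚ.toℕ<n i) i≮n

extend-+ : ∀ {n} {f g h : Fin n → ℕ} → (∀ i → f i + g i ≡ h i) →
           ∀ k → extend f k + extend g k ≡ extend h k
extend-+ {n} f+g≗h k with k <? n
... | yes k<n = f+g≗h (fromℕ< k<n)
... | no  _   = refl

sum-allFin : ∀ n (f : Fin n → ℕ) → sum (map f (allFin n)) ≡ ∑< n (extend f)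
sum-allFin n f = trans (cong sum (Listₚ.map-tabulate (λ i → i) f))
                       (sum-tabulate n (extend f) (λ i → sym (extend-toℕ f i)))

count : {A : Set} {P : A → Set} → Decidable P → List A → ℕ
count P? xs = length (filter P? xs)

module _ {A : Set} {P : A → Set} (P? : Decidable P) where

  count-∷ : ∀ x xs → count P? (x ∷ xs) ≡ ⟦ P? x ⟧ + count P? xs
  count-∷ x xs with does (P? x)
  ... | true  = refl
  ... | false = refl

  count-++ : ∀ xs ys → count P? (xs ++ ys) ≡ count P? xs + count P? ys
  count-++ xs ys = trans (cong length (Listₚ.filter-++ P? xs ys)) (Listₚ.length-++ (filter P? xs))

  count-concat : ∀ xss → count P? (concat xss) ≡ sum (map (count P?) xss)
  count-concat []         = refl
  count-concat (xs ∷ xss) = trans (count-++ xs (concat xss)) (cong (count P? xs +_) (count-concat xss))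

  count≤length : ∀ xs → count P? xs ≤ length xs
  count≤length = Listₚ.length-filter P?

  count-none : ∀ {xs} → (∀ {x} → x ∈ xs → ¬ P x) → count P? xs ≡ 0
  count-none {xs} ¬p = cong length (Listₚ.filter-none P? (All.tabulate ¬p))

  count-≥1 : ∀ {x xs} → x ∈ xs → P x → 1 ≤ count P? xs
  count-≥1 {xs = xs} x∈xs px with filter P? xs | ∈-filter⁺ P? x∈xs px
  ... | _ ∷ _ | _ = s≤s z≤n

  count+count-¬≡length : ∀ xs → count P? xs + count (¬? ∘ P?) xs ≡ length xs
  count+count-¬≡length []       = refl
  count+count-¬≡length (x ∷ xs) with P? x
  ... | yes _ = cong suc (count+count-¬≡length xs)
  ... | no  _ = trans (+-suc _ _) (cong suc (count+count-¬≡length xs))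

module _ {A : Set} {P Q : A → Set} (P? : Decidable P) (Q? : Decidable Q) where

  count-mono : (∀ {x} → P x → Q x) → ∀ xs → count P? xs ≤ count Q? xs
  count-mono P⇒Q []       = z≤n
  count-mono P⇒Q (x ∷ xs) with P? x | Q? x
  ... | yes _  | yes _  = s≤s (count-mono P⇒Q xs)
  ... | yes px | no ¬qx = contradiction (P⇒Q px) ¬qx
  ... | no  _  | yes _  = m≤n⇒m≤1+n (count-mono P⇒Q xs)
  ... | no  _  | no  _  = count-mono P⇒Q xs

count-map : ∀ {A B : Set} {P : B → Set} (P? : Decidable P) (f : A → B) xs →
            count P? (map f xs) ≡ count (P? ∘ f) xs
count-map P? f []       = refl
count-map P? f (x ∷ xs) with does (P? (f x))
... | true  = cong suc (count-map P? f xs)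
... | false = count-map P? f xs

module _ {A : Set} where

  lookup-injective : ∀ {xs : List A} → Unique xs → ∀ {i j} → lookup xs i ≡ lookup xs j → i ≡ j
  lookup-injective (_ ∷ _)     {zero}  {zero}  _ = refl
  lookup-injective (x∉xs ∷ _)  {zero}  {suc j} e = contradiction e (All.lookup x∉xs (∈-lookup j))
  lookup-injective (x∉xs ∷ _)  {suc i} {zero}  e = contradiction (sym e) (All.lookup x∉xs (∈-lookup i))
  lookup-injective (_ ∷ uniq)  {suc i} {suc j} e = cong suc (lookup-injective uniq e)

  length-≤-injection : ∀ {B : Set} {xs : List A} {ys : List B} → Unique xs → (f : A → B) →
    (∀ {x} → x ∈ xs → f x ∈ ys) → (∀ {x y} → x ∈ xs → y ∈ xs → f x ≡ f y → x ≡ y) →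
    length xs ≤ length ys
  length-≤-injection {xs = xs} {ys} uniq f into inj = Finₚ.injective⇒≤ index-injective
    where
    index : Fin (length xs) → Fin (length ys)
    index i = Any.index (into (∈-lookup i))
    index-injective : Injective _≡_ _≡_ index
    index-injective {i} {j} e = lookup-injective uniq (inj (∈-lookup i) (∈-lookup j) (begin
      f (lookup xs i)              ≡⟨ lookup-index (into (∈-lookup i)) ⟩
      lookup ys (index i)          ≡⟨ cong (lookup ys) e ⟩
      lookup ys (index j)          ≡⟨ lookup-index (into (∈-lookup j)) ⟨
      f (lookup xs j)              ∎))
      where open ≡-Reasoning

  count≤1 : ∀ {P : A → Set} (P? : Decidable P) {xs} → Unique xs →
            (∀ {x y} → x ∈ xs → y ∈ xs → P x → P y → x ≡ y) → count P? xs ≤ 1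
  count≤1 P? {xs} uniq same = length≤1 (Uniqueₚ.filter⁺ P? uniq) λ x∈ y∈ →
    let (x∈xs , px) = ∈-filter⁻ P? x∈ ; (y∈xs , py) = ∈-filter⁻ P? y∈ in same x∈xs y∈xs px py
    where
    length≤1 : ∀ {ys : List A} → Unique ys → (∀ {x y} → x ∈ ys → y ∈ ys → x ≡ y) → length ys ≤ 1
    length≤1 {[]}         _                _    = z≤n
    length≤1 {_ ∷ []}     _                _    = s≤s z≤n
    length≤1 {_ ∷ _ ∷ _}  ((x≢y ∷ _) ∷ _)  same = contradiction (same (here refl) (there (here refl))) x≢y

count-cartesianProduct : ∀ {A B : Set} {P : A × B → Set} (P? : Decidable P) xs ys →
  count P? (cartesianProduct xs ys) ≡ sum (map (λ x → count (λ y → P? (x , y)) ys) xs)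
count-cartesianProduct P? []       ys = refl
count-cartesianProduct P? (x ∷ xs) ys = begin
  count P? (map (x ,_) ys ++ cartesianProduct xs ys)               ≡⟨ count-++ P? (map (x ,_) ys) _ ⟩
  count P? (map (x ,_) ys) + count P? (cartesianProduct xs ys)     ≡⟨ cong₂ _+_ (count-map P? (λ y → x , y) ys)
                                                                        (count-cartesianProduct P? xs ys) ⟩
  count (λ y → P? (x , y)) ys + sum (map (λ x → count (λ y → P? (x , y)) ys) xs) ∎
  where open ≡-Reasoning

first-from : ∀ {P : ℕ → Set} → Decidable P → ∀ {k m} → k ≤ m → P m →
             ∃ λ j → k ≤ j × j ≤ m × P j × (∀ {t} → k ≤ t → t < j → ¬ P t)
first-from {P} P? {k} {m} k≤m pm with search (m ∸ k) k (subst P (sym (m∸n+n≡m k≤m)) pm)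
  where
  search : ∀ d k → P (d + k) → ∃ λ j → k ≤ j × j ≤ d + k × P j × (∀ {t} → k ≤ t → t < j → ¬ P t)
  search d k p with P? k
  ... | yes pk = k , ≤-refl , m≤n+m k d , pk , λ k≤t t<k → contradiction t<k (≤⇒≯ k≤t)
  search zero    k p | no ¬pk = contradiction p ¬pk
  search (suc d) k p | no ¬pk with search d (suc k) (subst P (sym (+-suc d k)) p)
  ... | j , k<j , j≤ , pj , none = j , <⇒≤ k<j , ≤-trans j≤ (≤-reflexive (+-suc d k)) , pj , earlier
    where
    earlier : ∀ {t} → k ≤ t → t < j → ¬ P t
    earlier {t} k≤t t<j with m≤n⇒m<n∨m≡n k≤t
    ... | inj₁ k<t  = none k<t t<j
    ... | inj₂ refl = ¬pk
... | j , k≤j , j≤ , pj , none = j , k≤j , ≤-trans j≤ (≤-reflexive (m∸n+n≡m k≤m)) , pj , none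

data Consecutive {A : Set} (u w : A) : List A → Set where
  here  : ∀ {xs} → Consecutive u w (u ∷ w ∷ xs)
  there : ∀ {x xs} → Consecutive u w xs → Consecutive u w (x ∷ xs)

module _ {A : Set} {u w : A} where

  Consecutive-++ˡ : ∀ {xs} ys → Consecutive u w xs → Consecutive u w (xs ++ ys)
  Consecutive-++ˡ ys here      = here
  Consecutive-++ˡ ys (there c) = there (Consecutive-++ˡ ys c)

  Consecutive-++ʳ : ∀ xs {ys} → Consecutive u w ys → Consecutive u w (xs ++ ys)
  Consecutive-++ʳ []       c = c
  Consecutive-++ʳ (x ∷ xs) c = there (Consecutive-++ʳ xs c)

  Consecutive-concat : ∀ {xs xss} → xs ∈ xss → Consecutive u w xs → Consecutive u w (concat xss)
  Consecutive-concat {xss = xs ∷ xss}  (here refl) c = Consecutive-++ˡ (concat xss) c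
  Consecutive-concat {xss = ys ∷ xss}  (there xs∈) c = Consecutive-++ʳ ys (Consecutive-concat xs∈ c)

  Consecutive-concat-map : ∀ {B : Set} (g : B → List A) {a a' ws} {bs : List B} →
    Consecutive a a' bs → g a ≡ u ∷ [] → g a' ≡ w ∷ ws → Consecutive u w (concat (map g bs))
  Consecutive-concat-map g here      ga ga' rewrite ga | ga' = here
  Consecutive-concat-map g {bs = b ∷ _} (there c) ga ga' = Consecutive-++ʳ (g b) (Consecutive-concat-map g c ga ga')

  Consecutive-lookup : ∀ {x rest} → Consecutive u w (x ∷ rest) →
    ∃ λ (j : Fin (length rest)) → lookup (x ∷ rest) (inject₁ j) ≡ u × lookup (x ∷ rest) (suc j) ≡ w
  Consecutive-lookup here = zero , refl , refl
  Consecutive-lookup {rest = _ ∷ _} (there c) with Consecutive-lookup c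
  ... | j , cⱼ≡u , cⱼ₊₁≡w = suc j , cⱼ≡u , cⱼ₊₁≡w

Consecutive-tabulate : ∀ {A : Set} {k} (f : Fin (suc k) → A) (j : Fin k) →
                       Consecutive (f (inject₁ j)) (f (suc j)) (tabulate f)
Consecutive-tabulate f zero    = here
Consecutive-tabulate f (suc j) = there (Consecutive-tabulate (f ∘ suc) j)

data LastOrInject₁ : ∀ {k} → Fin (suc k) → Set where
  last   : ∀ {k} → LastOrInject₁ (fromℕ k)
  inject : ∀ {k} (j : Fin k) → LastOrInject₁ (inject₁ j)

lastOrInject₁ : ∀ {k} (i : Fin (suc k)) → LastOrInject₁ i
lastOrInject₁ {zero}  zero    = last
lastOrInject₁ {suc k} zero    = inject zero
lastOrInject₁ {suc k} (suc i) with lastOrInject₁ i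
... | last     = last
... | inject j = inject (suc j)

next : ∀ {k} → Fin (suc k) → Fin (suc k)
next i with lastOrInject₁ i
... | last     = zero
... | inject j = suc j

lastOrInject₁-fromℕ : ∀ k → lastOrInject₁ (fromℕ k) ≡ last
lastOrInject₁-fromℕ zero    = refl
lastOrInject₁-fromℕ (suc k) rewrite lastOrInject₁-fromℕ k = refl

lastOrInject₁-inject₁ : ∀ {k} (j : Fin k) → lastOrInject₁ (inject₁ j) ≡ inject j
lastOrInject₁-inject₁ {suc k} zero    = refl
lastOrInject₁-inject₁ {suc k} (suc j) rewrite lastOrInject₁-inject₁ j = refl

next-fromℕ : ∀ k → next (fromℕ k) ≡ zero
next-fromℕ k rewrite lastOrInject₁-fromℕ k = refl

next-inject₁ : ∀ {k} (j : Fin k) → next (inject₁ j) ≡ suc j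
next-inject₁ j rewrite lastOrInject₁-inject₁ j = refl

toℕ-next : ∀ {k} (i : Fin (suc k)) → (toℕ i ≡ k × toℕ (next i) ≡ 0) ⊎ toℕ (next i) ≡ suc (toℕ i)
toℕ-next {k} i with lastOrInject₁ i
... | last     = inj₁ (Finₚ.toℕ-fromℕ k , refl)
... | inject j = inj₂ (cong suc (sym (Finₚ.toℕ-inject₁ j)))

next-injective : ∀ {k} → Injective _≡_ _≡_ (next {k})
next-injective {k} {i} {j} e with toℕ-next i | toℕ-next j
... | inj₁ (i≡k , _) | inj₁ (j≡k , _) = Finₚ.toℕ-injective (trans i≡k (sym j≡k))
... | inj₁ (_ , i'≡0) | inj₂ j'≡1+j = contradiction (trans (sym j'≡1+j) (trans (cong toℕ (sym e)) i'≡0)) λ ()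
... | inj₂ i'≡1+i | inj₁ (_ , j'≡0) = contradiction (trans (sym i'≡1+i) (trans (cong toℕ e) j'≡0)) λ ()
... | inj₂ i'≡1+i | inj₂ j'≡1+j =
  Finₚ.toℕ-injective (suc-injective (trans (sym i'≡1+i) (trans (cong toℕ e) j'≡1+j)))

next-≢ : ∀ {k} → 1 ≤ k → (i : Fin (suc k)) → next i ≢ i
next-≢ 1≤k i e with toℕ-next i
... | inj₁ (i≡k , i'≡0) = <⇒≢ 1≤k (trans (sym i'≡0) (trans (cong toℕ e) i≡k))
... | inj₂ i'≡1+i       = <⇒≢ (n<1+n (toℕ i)) (trans (sym (cong toℕ e)) i'≡1+i)

next²-≢ : ∀ {k} → 2 ≤ k → (i : Fin (suc k)) → next (next i) ≢ i
next²-≢ {k} 2≤k i e with toℕ-next i | toℕ-next (next i) | cong toℕ e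
... | inj₁ (_ , i'≡0) | inj₁ (i'≡k , _) | _ = <⇒≢ (≤-trans (s≤s z≤n) 2≤k) (trans (sym i'≡0) i'≡k)
... | inj₁ (i≡k , i'≡0) | inj₂ i''≡1+i' | i''≡i =
  <⇒≢ 2≤k (trans (cong suc (sym i'≡0)) (trans (sym i''≡1+i') (trans i''≡i i≡k)))
... | inj₂ i'≡1+i | inj₁ (i'≡k , i''≡0) | i''≡i =
  <⇒≢ 2≤k (trans (cong suc (trans (sym i''≡0) i''≡i)) (trans (sym i'≡1+i) i'≡k))
... | inj₂ i'≡1+i | inj₂ i''≡1+i' | i''≡i =
  <⇒≢ (m<n⇒m<1+n (n<1+n (toℕ i))) (trans (sym i''≡i) (trans i''≡1+i' (cong suc i'≡1+i)))

-- Hamiltonian cycles as successor maps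

NoTwoCycles : {V : Set} → (V → V) → Set
NoTwoCycles s = ∀ v → s (s v) ≢ v

hamiltonianCycle⇒successor : {V : Set} {H : V → V → Set} → HasHamiltonianCycle H →
  Σ (V → V) λ s → Injective _≡_ _≡_ s × NoTwoCycles s × (∀ v → H v (s v))
hamiltonianCycle⇒successor {V} {H} (k , 2≤k , c , c-injective , c-surjective , step , close) =
  s , s-injective , s-noTwoCycles , H-s
  where
  position : V → Fin (suc k)
  position v = proj₁ (c-surjective v)
  c-position : ∀ v → c (position v) ≡ v
  c-position v = proj₂ (c-surjective v)
  s : V → V
  s v = c (next (position v))
  H-next : ∀ i → H (c i) (c (next i))
  H-next i with lastOrInject₁ i
  ... | last     = close
  ... | inject j = step j
  H-s : ∀ v → H v (s v)
  H-s v = subst (λ u → H u (s v)) (c-position v) (H-next (position v))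
  s-injective : Injective _≡_ _≡_ s
  s-injective {u} {v} e =
    trans (sym (c-position u)) (trans (cong c (next-injective (c-injective e))) (c-position v))
  s-noTwoCycles : NoTwoCycles s
  s-noTwoCycles v e = next²-≢ 2≤k (position v) (c-injective (begin
    c (next (next (position v)))  ≡⟨ cong (c ∘ next) (c-injective (c-position (s v))) ⟨
    s (s v)                       ≡⟨ e ⟩
    v                             ≡⟨ c-position v ⟨
    c (position v)                ∎))
    where open ≡-Reasoning

module _ {V : Set} (E : V → V → Set) (E? : ∀ u v → Dec (E u v)) where

  nonEdge? : (s : V → V) → Decidable (λ v → ¬ E v (s v))
  nonEdge? s v = ¬? (E? v (s v))

  count-nonEdge≤length : ∀ F s → Injective _≡_ _≡_ s → NoTwoCycles s → (∀ v → AddEdges E F v (s v)) →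
                   ∀ {xs} → Unique xs → count (nonEdge? s) xs ≤ length F
  count-nonEdge≤length F s s-injective s-noTwoCycles H-s {xs} uniq =
    length-≤-injection (Uniqueₚ.filter⁺ (nonEdge? s) {xs} uniq) traversed
      (λ {v} v∈ → traversed∈F v (proj₂ (∈-filter⁻ (nonEdge? s) {xs = xs} v∈)))
      (λ _ _ → traversed-injective)
    where
    traversed : V → V × V
    traversed v with H-s v
    ... | inj₂ (inj₂ _) = s v , v
    ... | _             = v , s v
    traversed∈F : ∀ v → ¬ E v (s v) → traversed v ∈ F
    traversed∈F v ¬e with H-s v
    ... | inj₁ e        = contradiction e ¬e
    ... | inj₂ (inj₁ p) = p
    ... | inj₂ (inj₂ p) = p
    traversed-cases : ∀ v → traversed v ≡ (v , s v) ⊎ traversed v ≡ (s v , v)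
    traversed-cases v with H-s v
    ... | inj₁ _        = inj₁ refl
    ... | inj₂ (inj₁ _) = inj₁ refl
    ... | inj₂ (inj₂ _) = inj₂ refl
    traversed-injective : Injective _≡_ _≡_ traversed
    traversed-injective {u} {v} e with traversed-cases u | traversed-cases v
    ... | inj₁ p | inj₁ q = cong proj₁ (trans (sym p) (trans e q))
    ... | inj₂ p | inj₂ q = cong proj₂ (trans (sym p) (trans e q))
    ... | inj₁ p | inj₂ q = contradiction (trans (cong s (sym u≡sv)) su≡v) (s-noTwoCycles v)
      where
      u≡sv = cong proj₁ (trans (sym p) (trans e q))
      su≡v = cong proj₂ (trans (sym p) (trans e q))
    ... | inj₂ p | inj₁ q = contradiction (trans (cong s su≡v) (sym u≡sv)) (s-noTwoCycles u)
      where
      su≡v = cong proj₁ (trans (sym p) (trans e q))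
      u≡sv = cong proj₂ (trans (sym p) (trans e q))

  module Listing {x : V} {rest : List V} (uniq : Unique (x ∷ rest)) (complete : ∀ v → v ∈ x ∷ rest)
                 (2≤N : 2 ≤ length rest)
    where

    N : ℕ
    N = length rest

    c : Fin (suc N) → V
    c = lookup (x ∷ rest)

    c-injective : Injective _≡_ _≡_ c
    c-injective = lookup-injective uniq

    position : V → Fin (suc N)
    position v = Any.index (complete v)

    c-position : ∀ v → c (position v) ≡ v
    c-position v = sym (lookup-index (complete v))

    successor : V → V
    successor v = c (next (position v))

    successor-c : ∀ i → successor (c i) ≡ c (next i)
    successor-c i = cong (c ∘ next) (c-injective (c-position (c i)))

    successor-consecutive : ∀ {u w} → Consecutive u w (x ∷ rest) → successor u ≡ w
    successor-consecutive cons with Consecutive-lookup cons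
    ... | j , refl , refl = trans (successor-c (inject₁ j)) (cong c (next-inject₁ j))

    step : Fin (suc N) → V × V
    step i = c i , c (next i)

    nonEdgePair? : Decidable (λ (e : V × V) → ¬ E (proj₁ e) (proj₂ e))
    nonEdgePair? (u , w) = ¬? (E? u w)

    missing : List (V × V)
    missing = filter nonEdgePair? (map step (allFin (suc N)))

    ∈-missing⁻ : ∀ {e} → e ∈ missing → ∃ λ i → e ≡ step i × ¬ E (c i) (c (next i))
    ∈-missing⁻ e∈ with ∈-filter⁻ nonEdgePair? {xs = map step (allFin _)} e∈
    ... | e∈steps , ¬e with ∈-map⁻ step e∈steps
    ...   | i , _ , refl = i , refl , ¬e

    missing-valid : ValidAddition E missing
    missing-valid = All.tabulate (loopless ∘ ∈-missing⁻)
                  , AllPairsₚ.filter⁺ nonEdgePair?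
                      (AllPairsₚ.map⁺ (AllPairs.map distinct (Uniqueₚ.allFin⁺ (suc N))))
      where
      loopless : ∀ {e} → (∃ λ i → e ≡ step i × ¬ E (c i) (c (next i))) →
                 (proj₁ e ≢ proj₂ e) × ¬ E (proj₁ e) (proj₂ e)
      loopless (i , refl , ¬e) =
        (λ cᵢ≡cᵢ' → next-≢ (≤-trans (s≤s z≤n) 2≤N) i (sym (c-injective cᵢ≡cᵢ'))) , ¬e
      distinct : ∀ {i j} → i ≢ j → ¬ SamePair (step i) (step j)
      distinct i≢j (inj₁ (cᵢ≡cⱼ , _)) = i≢j (c-injective cᵢ≡cⱼ)
      distinct {i} {j} _ (inj₂ (cᵢ≡cⱼ' , cᵢ'≡cⱼ)) =
        next²-≢ 2≤N j (trans (cong next (sym (c-injective cᵢ≡cⱼ'))) (c-injective cᵢ'≡cⱼ))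

    missing-cycle : HasHamiltonianCycle (AddEdges E missing)
    missing-cycle = N , 2≤N , c , c-injective , (λ v → position v , c-position v)
                  , (λ j → subst (AddEdges E missing (c (inject₁ j)) ∘ c) (next-inject₁ j) (H-step (inject₁ j)))
                  , subst (AddEdges E missing (c (fromℕ N)) ∘ c) (next-fromℕ N) (H-step (fromℕ N))
      where
      H-step : ∀ i → AddEdges E missing (c i) (c (next i))
      H-step i with E? (c i) (c (next i))
      ... | yes e  = inj₁ e
      ... | no  ¬e = inj₂ (inj₁ (∈-filter⁺ nonEdgePair? (∈-map⁺ step (∈-allFin i)) ¬e))

    length-missing : length missing ≤ count (nonEdge? successor) (x ∷ rest)
    length-missing = begin
      count nonEdgePair? (map step (allFin (suc N)))      ≡⟨ count-map nonEdgePair? step (allFin _) ⟩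
      count (nonEdgePair? ∘ step) (allFin (suc N))        ≤⟨ count-mono (nonEdgePair? ∘ step) (nonEdge? successor ∘ c)
                                                                          step⇒nonEdge (allFin (suc N)) ⟩
      count (nonEdge? successor ∘ c) (allFin (suc N))     ≡⟨ count-map (nonEdge? successor) c (allFin _) ⟨
      count (nonEdge? successor) (map c (allFin (suc N))) ≡⟨ cong (count (nonEdge? successor)) map-c-allFin ⟩
      count (nonEdge? successor) (x ∷ rest)               ∎
      where
      open ≤-Reasoning
      step⇒nonEdge : ∀ {i} → ¬ E (c i) (c (next i)) → ¬ E (c i) (successor (c i))
      step⇒nonEdge {i} = subst (¬_ ∘ E (c i)) (sym (successor-c i))
      map-c-allFin : map c (allFin (suc N)) ≡ x ∷ rest
      map-c-allFin = trans (Listₚ.map-tabulate (λ i → i) c) (Listₚ.tabulate-lookup (x ∷ rest))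

  listing⇒completion : ∀ {xs} → Unique xs → (∀ v → v ∈ xs) → 3 ≤ length xs →
    Σ (List (V × V)) λ F → ValidAddition E F × HasHamiltonianCycle (AddEdges E F) ×
      Σ (V → V) λ s → (∀ {u w} → Consecutive u w xs → s u ≡ w) × length F ≤ count (nonEdge? s) xs
  listing⇒completion {_ ∷ _} uniq complete (s≤s 2≤N) =
    missing , missing-valid , missing-cycle , successor , successor-consecutive , length-missing
    where open Listing uniq complete 2≤N

-- Falls and rises of a predicate on ℕ

module LeafProfile (leafy : ℕ → Set) (leafy? : Decidable leafy) where

  fall? : Decidable (λ k → leafy k × ¬ leafy (suc k))
  fall? k = leafy? k ×-dec ¬? (leafy? (suc k))

  rise? : Decidable (λ k → ¬ leafy k × leafy (suc k))
  rise? k = ¬? (leafy? k) ×-dec leafy? (suc k)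

  falls+last≡rises+first : ∀ m →
    ∑[ k < m ] ⟦ fall? k ⟧ + ⟦ leafy? m ⟧ ≡ ∑[ k < m ] ⟦ rise? k ⟧ + ⟦ leafy? 0 ⟧
  falls+last≡rises+first zero    = refl
  falls+last≡rises+first (suc m) = begin
    F + f + ⟦ leafy? (suc m) ⟧   ≡⟨ +-assoc F f _ ⟩
    F + (f + ⟦ leafy? (suc m) ⟧) ≡⟨ cong (F +_) (local m) ⟩
    F + (⟦ leafy? m ⟧ + r)       ≡⟨ +-assoc F _ r ⟨
    F + ⟦ leafy? m ⟧ + r         ≡⟨ cong (_+ r) (falls+last≡rises+first m) ⟩
    R + ⟦ leafy? 0 ⟧ + r         ≡⟨ xy∙z≈xz∙y R _ r ⟩
    R + r + ⟦ leafy? 0 ⟧         ∎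
    where
    open ≡-Reasoning
    F = ∑[ k < m ] ⟦ fall? k ⟧
    R = ∑[ k < m ] ⟦ rise? k ⟧
    f = ⟦ fall? m ⟧
    r = ⟦ rise? m ⟧
    local : ∀ q → ⟦ fall? q ⟧ + ⟦ leafy? (suc q) ⟧ ≡ ⟦ leafy? q ⟧ + ⟦ rise? q ⟧
    local q with leafy? q | leafy? (suc q)
    ... | yes _ | yes _ = refl
    ... | yes _ | no  _ = refl
    ... | no  _ | yes _ = refl
    ... | no  _ | no  _ = refl

  falls≡rises : ∀ {m} → leafy 0 → leafy m → ∑[ k < m ] ⟦ fall? k ⟧ ≡ ∑[ k < m ] ⟦ rise? k ⟧
  falls≡rises {m} leafy-0 leafy-m = +-cancelʳ-≡ 1 _ _ (begin
    ∑[ k < m ] ⟦ fall? k ⟧ + 1              ≡⟨ cong (∑< m (⟦_⟧ ∘ fall?) +_) (⟦⟧-yes (leafy? m) leafy-m) ⟨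
    ∑[ k < m ] ⟦ fall? k ⟧ + ⟦ leafy? m ⟧   ≡⟨ falls+last≡rises+first m ⟩
    ∑[ k < m ] ⟦ rise? k ⟧ + ⟦ leafy? 0 ⟧   ≡⟨ cong (∑< m (⟦_⟧ ∘ rise?) +_) (⟦⟧-yes (leafy? 0) leafy-0) ⟩
    ∑[ k < m ] ⟦ rise? k ⟧ + 1              ∎)
    where open ≡-Reasoning

  module Credit (m : ℕ) (Arc : ℕ → ℕ → Set) (Arc? : ∀ j k → Dec (Arc j k)) (credit : ℕ → ℕ)
    (leafy-m : leafy m)
    (Arc-asym : ∀ {j k} → Arc j k → ¬ Arc k j)
    (Arc-injective : ∀ {i j k} → Arc i k → Arc j k → i ≡ j)
    (credit-leafy : ∀ {j k} → k ≤ m → leafy k → Arc j k → 1 ≤ credit k)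
    (credit-bare : ∀ {k} → suc k ≤ m → ¬ leafy (suc k) → ¬ Arc (suc k) k → ¬ Arc (suc k) (suc (suc k)) →
                   1 ≤ credit (suc k))
    where

    enteredFromRight? : Decidable (λ k → leafy k × Arc (suc k) k)
    enteredFromRight? k = leafy? k ×-dec Arc? (suc k) k

    bareLeavingRight? : Decidable (λ k → ¬ leafy k × Arc k (suc k))
    bareLeavingRight? k = ¬? (leafy? k) ×-dec Arc? k (suc k)

    potential-step : ∀ q → suc q ≤ m →
      ⟦ fall? q ⟧ + ⟦ enteredFromRight? (suc q) ⟧ + ⟦ bareLeavingRight? q ⟧ ≤
      ⟦ enteredFromRight? q ⟧ + credit (suc q) + ⟦ bareLeavingRight? (suc q) ⟧
    potential-step q q<m with leafy? q | leafy? (suc q)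
    ... | yes _  | yes leafy' =
      +-monoˡ-≤ 0 (≤-trans (⟦⟧≤ (Arc? _ _) (credit-leafy q<m leafy')) (m≤n+m _ _))
    ... | no  _  | yes leafy' with Arc? (suc (suc q)) (suc q) | Arc? q (suc q)
    ...   | yes a | yes a' = contradiction (Arc-injective a a') (<⇒≢ (m<n⇒m<1+n (n<1+n q)) ∘ sym)
    ...   | yes a | no  _  = ≤-trans (credit-leafy q<m leafy' a) (m≤m+n _ 0)
    ...   | no  _ | yes a' = ≤-trans (credit-leafy q<m leafy' a') (m≤m+n _ 0)
    ...   | no  _ | no  _  = z≤n
    potential-step q q<m | yes _ | no bare' with Arc? (suc q) q | Arc? (suc q) (suc (suc q))
    ...   | yes _ | _      = s≤s z≤n
    ...   | no  _ | yes _  = m≤n+m 1 _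
    ...   | no ¬a | no ¬a' = ≤-trans (credit-bare q<m bare' ¬a ¬a') (m≤m+n _ 0)
    potential-step q q<m | no _ | no bare' with Arc? q (suc q)
    ...   | no  _ = z≤n
    ...   | yes a with Arc? (suc q) (suc (suc q))
    ...     | yes _  = m≤n+m 1 _
    ...     | no ¬a' = ≤-trans (credit-bare q<m bare' (Arc-asym a) ¬a') (m≤m+n _ 0)

    -- Scanning left to right: the falls before q are paid by the credits up to q, except that one
    -- payment may still be owed if the bare position q steps right, and the credit of a leafy q
    -- entered from the right is reserved for the 0-leaf segment starting at q.
    potential : ∀ q → q ≤ m →
      ∑[ k < q ] ⟦ fall? k ⟧ + ⟦ enteredFromRight? q ⟧ ≤ ∑[ k < suc q ] credit k + ⟦ bareLeavingRight? q ⟧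
    potential zero _ =
      ≤-trans (⟦⟧≤ (enteredFromRight? 0) λ (leafy₀ , a) → credit-leafy z≤n leafy₀ a) (m≤m+n (credit 0) _)
    potential (suc q) q<m = +-cancelˡ-≤ b _ _ (begin
      b + (St + f + e')          ≡⟨ rearrange₁ b St f e' ⟩
      St + (f + e' + b)          ≤⟨ +-monoʳ-≤ St (potential-step q q<m) ⟩
      St + (e + c' + b')         ≡⟨ rearrange₂ St e c' b' ⟩
      (St + e) + (c' + b')       ≤⟨ +-monoˡ-≤ (c' + b') (potential q (≤-trans (n≤1+n q) q<m)) ⟩
      (Cr + b) + (c' + b')       ≡⟨ rearrange₃ Cr b c' b' ⟩
      b + (Cr + c' + b')         ∎)
      where
      open ≤-Reasoning
      St = ∑[ k < q ] ⟦ fall? k ⟧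
      Cr = ∑[ k < suc q ] credit k
      f  = ⟦ fall? q ⟧
      e  = ⟦ enteredFromRight? q ⟧
      e' = ⟦ enteredFromRight? (suc q) ⟧
      b  = ⟦ bareLeavingRight? q ⟧
      b' = ⟦ bareLeavingRight? (suc q) ⟧
      c' = credit (suc q)
      rearrange₁ : ∀ b s f e → b + (s + f + e) ≡ s + (f + e + b)
      rearrange₁ = solve-∀
      rearrange₂ : ∀ s e c b' → s + (e + c + b') ≡ s + e + (c + b')
      rearrange₂ = solve-∀
      rearrange₃ : ∀ C b c b' → C + b + (c + b') ≡ b + (C + c + b')
      rearrange₃ = solve-∀

    falls≤credit : ∑[ k < m ] ⟦ fall? k ⟧ ≤ ∑[ k < suc m ] credit k
    falls≤credit = begin
      ∑[ k < m ] ⟦ fall? k ⟧                                         ≤⟨ m≤m+n _ _ ⟩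
      ∑[ k < m ] ⟦ fall? k ⟧ + ⟦ enteredFromRight? m ⟧               ≤⟨ potential m ≤-refl ⟩
      ∑[ k < suc m ] credit k + ⟦ bareLeavingRight? m ⟧              ≡⟨ cong (_ +_) (⟦⟧-no (bareLeavingRight? m)
                                                                           λ (bare , _) → bare leafy-m) ⟩
      ∑[ k < suc m ] credit k + 0                                    ≡⟨ +-identityʳ _ ⟩
      ∑[ k < suc m ] credit k                                        ∎
      where open ≤-Reasoning

-- The caterpillar

insertAfterHead : {A : Set} → A → List A → List A
insertAfterHead x []       = x ∷ []
insertAfterHead x (y ∷ ys) = y ∷ x ∷ ys

module _ {A : Set} {x : A} where

  ∈-insertAfterHeadˡ : ∀ ys → x ∈ insertAfterHead x ys
  ∈-insertAfterHeadˡ []      = here refl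
  ∈-insertAfterHeadˡ (_ ∷ _) = there (here refl)

  ∈-insertAfterHeadʳ : ∀ {y ys} → y ∈ ys → y ∈ insertAfterHead x ys
  ∈-insertAfterHeadʳ (here y≡)  = here y≡
  ∈-insertAfterHeadʳ (there y∈) = there (there y∈)

  ∈-insertAfterHead⁻ : ∀ {y} ys → y ∈ insertAfterHead x ys → y ≡ x ⊎ y ∈ ys
  ∈-insertAfterHead⁻ []       (here y≡x)          = inj₁ y≡x
  ∈-insertAfterHead⁻ (_ ∷ _)  (here y≡)           = inj₂ (here y≡)
  ∈-insertAfterHead⁻ (_ ∷ _)  (there (here y≡x))  = inj₁ y≡x
  ∈-insertAfterHead⁻ (_ ∷ _)  (there (there y∈))  = inj₂ (there y∈)

  insertAfterHead⁺ : ∀ {ys} → All (x ≢_) ys → Unique ys → Unique (insertAfterHead x ys)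
  insertAfterHead⁺ {[]}     _              _               = [] ∷ []
  insertAfterHead⁺ {y ∷ ys} (x≢y ∷ x≢ys)  (y∉ys ∷ uniq)  = ((x≢y ∘ sym) ∷ y∉ys) ∷ x≢ys ∷ uniq

  length-insertAfterHead : ∀ ys → length (insertAfterHead x ys) ≡ suc (length ys)
  length-insertAfterHead []      = refl
  length-insertAfterHead (_ ∷ _) = refl

count-insertAfterHead : ∀ {A : Set} {P : A → Set} (P? : Decidable P) x ys →
                        count P? (insertAfterHead x ys) ≡ ⟦ P? x ⟧ + count P? ys
count-insertAfterHead P? x []       = count-∷ P? x []
count-insertAfterHead P? x (y ∷ ys) = begin
  count P? (y ∷ x ∷ ys)                     ≡⟨ count-∷ P? y (x ∷ ys) ⟩
  ⟦ P? y ⟧ + count P? (x ∷ ys)              ≡⟨ cong (⟦ P? y ⟧ +_) (count-∷ P? x ys) ⟩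
  ⟦ P? y ⟧ + (⟦ P? x ⟧ + count P? ys)       ≡⟨ x∙yz≈y∙xz ⟦ P? y ⟧ ⟦ P? x ⟧ (count P? ys) ⟩
  ⟦ P? x ⟧ + (⟦ P? y ⟧ + count P? ys)       ≡⟨ cong (⟦ P? x ⟧ +_) (count-∷ P? y ys) ⟨
  ⟦ P? x ⟧ + count P? (y ∷ ys)              ∎
  where open ≡-Reasoning

tabulate-≡[] : ∀ {A : Set} {k} (f : Fin k → A) → k ≡ 0 → tabulate f ≡ []
tabulate-≡[] {k = zero} f _ = refl

module Caterpillar {n : ℕ} (l : Fin n → ℕ) where

  V : Set
  V = Vtx n l

  spine-injective : ∀ {i j} → spine {n} {l} i ≡ spine j → i ≡ j
  spine-injective refl = refl

  _≟_ : (u v : V) → Dec (u ≡ v)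
  spine i  ≟ spine j with i Fin.≟ j
  ... | yes refl = yes refl
  ... | no  i≢j  = no (i≢j ∘ spine-injective)
  spine _  ≟ leaf _ _ = no λ ()
  leaf _ _ ≟ spine _  = no λ ()
  leaf i x ≟ leaf j y with i Fin.≟ j
  ... | no  i≢j  = no λ { refl → i≢j refl }
  ... | yes refl with x Fin.≟ y
  ...   | yes refl = yes refl
  ...   | no  x≢y  = no λ { refl → x≢y refl }

  adj? : (u v : V) → Dec (Adj u v)
  adj? (spine i) (spine j) with suc (toℕ i) ℕ.≟ toℕ j | suc (toℕ j) ℕ.≟ toℕ i
  ... | yes i→j | _       = yes (path→ i→j)
  ... | no  _   | yes j→i = yes (path← j→i)
  ... | no ¬i→j | no ¬j→i = no λ { (path→ i→j) → ¬i→j i→j ; (path← j→i) → ¬j→i j→i }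
  adj? (spine i) (leaf j y) with i Fin.≟ j
  ... | yes refl = yes (sp-lf y)
  ... | no  i≢j  = no λ { (sp-lf _) → i≢j refl }
  adj? (leaf i x) (spine j) with i Fin.≟ j
  ... | yes refl = yes (lf-sp x)
  ... | no  i≢j  = no λ { (lf-sp _) → i≢j refl }
  adj? (leaf _ _) (leaf _ _) = no λ ()

  leaf-adj : ∀ {i x} {w : V} → Adj (leaf i x) w → w ≡ spine i
  leaf-adj (lf-sp _) = refl

  spine-adj : ∀ {i} {w : V} → Adj (spine i) w →
    (∃ λ j → w ≡ spine j × (suc (toℕ i) ≡ toℕ j ⊎ suc (toℕ j) ≡ toℕ i)) ⊎
    (∃ λ x → w ≡ leaf i x)
  spine-adj (path→ i→j) = inj₁ (_ , refl , inj₁ i→j)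
  spine-adj (path← j→i) = inj₁ (_ , refl , inj₂ j→i)
  spine-adj (sp-lf x)   = inj₂ (x , refl)

  spineIndex : V → Fin n
  spineIndex (spine i)  = i
  spineIndex (leaf i _) = i

  leaves : Fin n → List V
  leaves i = tabulate (leaf i)

  -- v_i is listed second, as x₀ v_i x₁ …, so that the listing steps x₀ → v_i → x₁ along tree edges.
  group : Fin n → List V
  group i = insertAfterHead (spine i) (leaves i)

  vertices : List V
  vertices = concat (map group (allFin n))

  ∈-group⇒spineIndex : ∀ i {v} → v ∈ group i → spineIndex v ≡ i
  ∈-group⇒spineIndex i v∈ with ∈-insertAfterHead⁻ (leaves i) v∈
  ... | inj₁ refl = refl
  ... | inj₂ v∈leaves with ∈-tabulate⁻ v∈leaves
  ...   | _ , refl = refl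

  ∈-vertices : ∀ v → v ∈ vertices
  ∈-vertices v = ∈-concat⁺′ (∈-group v) (∈-map⁺ group (∈-allFin (spineIndex v)))
    where
    ∈-group : ∀ v → v ∈ group (spineIndex v)
    ∈-group (spine i)  = ∈-insertAfterHeadˡ (leaves i)
    ∈-group (leaf i x) = ∈-insertAfterHeadʳ (∈-tabulate⁺ x)

  vertices-unique : Unique vertices
  vertices-unique = Uniqueₚ.concat⁺
    (Allₚ.map⁺ (All.tabulate λ {i} _ →
      insertAfterHead⁺ (Allₚ.tabulate⁺ λ _ ()) (Uniqueₚ.tabulate⁺ λ { refl → refl })))
    (AllPairsₚ.map⁺ (AllPairs.map disjoint (Uniqueₚ.allFin⁺ n)))
    where
    disjoint : ∀ {i j} → i ≢ j → ∀ {v} → ¬ (v ∈ group i × v ∈ group j)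
    disjoint {i} {j} i≢j (v∈i , v∈j) =
      i≢j (trans (sym (∈-group⇒spineIndex i v∈i)) (∈-group⇒spineIndex j v∈j))

  module Successor (s : V → V) where

    bad? : Decidable (λ v → ¬ Adj v (s v))
    bad? = nonEdge? Adj adj? s

    badIn : Fin n → ℕ
    badIn i = count bad? (group i)

    count-bad≡∑badIn : count bad? vertices ≡ ∑< n (extend badIn)
    count-bad≡∑badIn = begin
      count bad? (concat (map group (allFin n)))      ≡⟨ count-concat bad? (map group (allFin n)) ⟩
      sum (map (count bad?) (map group (allFin n)))   ≡⟨ cong sum (Listₚ.map-∘ (allFin n)) ⟨
      sum (map badIn (allFin n))                      ≡⟨ sum-allFin n badIn ⟩
      ∑< n (extend badIn)                             ∎
      where open ≡-Reasoning

  Leafy : ℕ → Set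
  Leafy k = 2 ≤ extend l k

  leafy? : Decidable Leafy
  leafy? k = 2 ≤? extend l k

  open LeafProfile Leafy leafy? public

  excess : Fin n → ℕ
  excess i = if does (2 ≤? l i) then l i ∸ 1 else 0

  leafExcess≡∑ : leafExcess l ≡ ∑< n (extend excess)
  leafExcess≡∑ = sum-allFin n excess

  excess-leafy : ∀ {i} → 2 ≤ l i → excess i ≡ l i ∸ 1
  excess-leafy {i} leafy = cong (if_then l i ∸ 1 else 0) (dec-true (2 ≤? l i) leafy)

  excess-bare : ∀ {i} → l i ≡ 0 → excess i ≡ 0
  excess-bare {i} l≡0 = cong (if_then l i ∸ 1 else 0) (dec-false (2 ≤? l i) (<⇒≱ (s≤s z≤n) ∘ subst (2 ≤_) l≡0))

module Segments (m : ℕ) (l : Fin (suc m) → ℕ)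
  (dichotomy : ∀ i → 2 ≤ l i ⊎ l i ≡ 0) (leafy-last : 2 ≤ l (fromℕ m)) where

  open Caterpillar l

  Leafy-toℕ⁺ : ∀ {i} → 2 ≤ l i → Leafy (toℕ i)
  Leafy-toℕ⁺ {i} = subst (2 ≤_) (sym (extend-toℕ l i))

  Leafy-toℕ⁻ : ∀ {i} → Leafy (toℕ i) → 2 ≤ l i
  Leafy-toℕ⁻ {i} = subst (2 ≤_) (extend-toℕ l i)

  Leafy-m : Leafy m
  Leafy-m = subst Leafy (Finₚ.toℕ-fromℕ m) (Leafy-toℕ⁺ leafy-last)

  bare⇒l≡0 : ∀ {i} → ¬ Leafy (toℕ i) → l i ≡ 0
  bare⇒l≡0 {i} ¬leafy with dichotomy i
  ... | inj₁ leafy = contradiction (Leafy-toℕ⁺ leafy) ¬leafy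
  ... | inj₂ l≡0   = l≡0

  l≡0⇒bare : ∀ {i} → l i ≡ 0 → ¬ Leafy (toℕ i)
  l≡0⇒bare {i} l≡0 leafy with subst (2 ≤_) l≡0 (Leafy-toℕ⁻ leafy)
  ... | ()

  spineAt : ∀ {k} → k ≤ m → ∃ λ (i : Fin (suc m)) → toℕ i ≡ k
  spineAt k≤m = fromℕ< (s≤s k≤m) , Finₚ.toℕ-fromℕ< (s≤s k≤m)

  toℕ≤m : ∀ (i : Fin (suc m)) → toℕ i ≤ m
  toℕ≤m i = s≤s⁻¹ (Finₚ.toℕ<n i)

  +2≤⇒suc< : ∀ {a b} → a + 2 ≤ b → suc a < b
  +2≤⇒suc< {a} a+2≤b = ≤-trans (≤-reflexive (+-comm 2 a)) a+2≤b

  Segment : Fin (suc m) → Fin (suc m) → Set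
  Segment = ZeroLeafSegment l

  segment⇒fall : ∀ {i j} → Segment i j → Leafy (toℕ i) × ¬ Leafy (suc (toℕ i))
  segment⇒fall {i} {j} (i+2≤j , leafy-i , _ , inside)
    with spineAt (≤-trans (<⇒≤ (+2≤⇒suc< i+2≤j)) (toℕ≤m j))
  ... | i' , i'≡1+i =
    Leafy-toℕ⁺ leafy-i ,
    subst (¬_ ∘ Leafy) i'≡1+i (l≡0⇒bare (inside i' (≤-reflexive (sym i'≡1+i))
                                                    (subst (_< toℕ j) (sym i'≡1+i) (+2≤⇒suc< i+2≤j))))

  segment-unique : ∀ {i j j'} → Segment i j → Segment i j' → j ≡ j'
  segment-unique {i} {j} {j'} (i+2≤j , _ , leafy-j , inside) (i+2≤j' , _ , leafy-j' , inside')
    with <-cmp (toℕ j) (toℕ j')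
  ... | tri≈ _ j≡j' _ = Finₚ.toℕ-injective j≡j'
  ... | tri< j<j' _ _ =
    contradiction (Leafy-toℕ⁺ leafy-j) (l≡0⇒bare (inside' j (<⇒≤ (+2≤⇒suc< i+2≤j)) j<j'))
  ... | tri> _ _ j'<j =
    contradiction (Leafy-toℕ⁺ leafy-j') (l≡0⇒bare (inside j' (<⇒≤ (+2≤⇒suc< i+2≤j')) j'<j))

  fall⇒segment : ∀ {i} → toℕ i < m → Leafy (toℕ i) → ¬ Leafy (suc (toℕ i)) → ∃ (Segment i)
  fall⇒segment {i} i<m leafy-i bare-i' with first-from leafy? i<m Leafy-m
  ... | j , i<j , j≤m , leafy-j , none with spineAt j≤m
  ...   | j' , refl =
    j' , i+2≤j' , Leafy-toℕ⁻ leafy-i , Leafy-toℕ⁻ leafy-j , λ k i<k k<j' → bare⇒l≡0 (none i<k k<j')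
    where
    i+2≤j' : toℕ i + 2 ≤ toℕ j'
    i+2≤j' with m≤n⇒m<n∨m≡n i<j
    ... | inj₁ i+1<j = ≤-trans (≤-reflexive (+-comm (toℕ i) 2)) i+1<j
    ... | inj₂ i+1≡j = contradiction (subst Leafy (sym i+1≡j) leafy-j) bare-i'

  segment? : ∀ i → Decidable (Segment i)
  segment? i j = zeroLeafSegment? l (i , j)

  segmentsFrom : Fin (suc m) → ℕ
  segmentsFrom i = count (segment? i) (allFin (suc m))

  segmentsFrom≡fall : ∀ i → toℕ i < m → segmentsFrom i ≡ ⟦ fall? (toℕ i) ⟧
  segmentsFrom≡fall i i<m with fall? (toℕ i)
  ... | yes falls@(leafy-i , bare-i') with fall⇒segment i<m leafy-i bare-i'
  ...   | j , seg = trans (≤-antisym (count≤1 (segment? i) (Uniqueₚ.allFin⁺ _) λ _ _ → segment-unique)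
                                     (count-≥1 (segment? i) (∈-allFin j) seg))
                          (sym (⟦⟧-yes (fall? (toℕ i)) falls))
  segmentsFrom≡fall i i<m | no ¬falls =
    trans (count-none (segment? i) {allFin (suc m)} λ _ seg → ¬falls (segment⇒fall seg))
          (sym (⟦⟧-no (fall? (toℕ i)) ¬falls))

  segmentsFrom-last : segmentsFrom (fromℕ m) ≡ 0
  segmentsFrom-last = count-none (segment? (fromℕ m)) {allFin (suc m)} λ {j} _ (m+2≤j , _) →
    <⇒≱ (+2≤⇒suc< m+2≤j) (≤-trans (toℕ≤m j) (≤-trans (n≤1+n m) (≤-reflexive (cong suc (sym (Finₚ.toℕ-fromℕ m))))))

  P0≡falls : P0 l ≡ ∑[ k < m ] ⟦ fall? k ⟧
  P0≡falls = begin
    P0 l                                                   ≡⟨ count-cartesianProduct (zeroLeafSegment? l) (allFin _) (allFin _) ⟩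
    sum (map segmentsFrom (allFin (suc m)))                ≡⟨ sum-allFin (suc m) segmentsFrom ⟩
    ∑< m (extend segmentsFrom) + extend segmentsFrom m     ≡⟨ cong₂ _+_ (∑-cong m inner) final ⟩
    ∑[ k < m ] ⟦ fall? k ⟧ + 0                             ≡⟨ +-identityʳ _ ⟩
    ∑[ k < m ] ⟦ fall? k ⟧                                 ∎
    where
    open ≡-Reasoning
    inner : ∀ k → k < m → extend segmentsFrom k ≡ ⟦ fall? k ⟧
    inner k k<m with spineAt (<⇒≤ k<m)
    ... | i , refl = trans (extend-toℕ segmentsFrom i) (segmentsFrom≡fall i k<m)
    final : extend segmentsFrom m ≡ 0
    final = subst (λ k → extend segmentsFrom k ≡ 0) (Finₚ.toℕ-fromℕ m)
                 (trans (extend-toℕ segmentsFrom (fromℕ m)) segmentsFrom-last)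

module LowerBound (m : ℕ) (l : Fin (suc m) → ℕ)
  (dichotomy : ∀ i → 2 ≤ l i ⊎ l i ≡ 0) (leafy-last : 2 ≤ l (fromℕ m))
  (s : Vtx (suc m) l → Vtx (suc m) l) (s-injective : Injective _≡_ _≡_ s) (s-noTwoCycles : NoTwoCycles s)
  where

  open Caterpillar l
  open Segments m l dichotomy leafy-last
  open Successor s

  good? : Decidable (λ v → Adj v (s v))
  good? v = adj? v (s v)

  leaves-unique : ∀ i → Unique (leaves i)
  leaves-unique i = Uniqueₚ.tabulate⁺ λ { refl → refl }

  good-leaf : ∀ {i v} → v ∈ leaves i → Adj v (s v) → s v ≡ spine i
  good-leaf v∈ adj with ∈-tabulate⁻ v∈
  ... | _ , refl = leaf-adj adj

  bad-leaves+good-leaves : ∀ i → count bad? (leaves i) + count good? (leaves i) ≡ l i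
  bad-leaves+good-leaves i = begin
    count bad? (leaves i) + count good? (leaves i)   ≡⟨ +-comm (count bad? (leaves i)) _ ⟩
    count good? (leaves i) + count bad? (leaves i)   ≡⟨ count+count-¬≡length good? (leaves i) ⟩
    length (leaves i)                                ≡⟨ Listₚ.length-tabulate {n = l i} (leaf i) ⟩
    l i                                              ∎
    where open ≡-Reasoning

  good-leaves≤1 : ∀ i → count good? (leaves i) ≤ 1
  good-leaves≤1 i = count≤1 good? (leaves-unique i) λ v∈ w∈ good-v good-w →
    s-injective (trans (good-leaf v∈ good-v) (sym (good-leaf w∈ good-w)))

  good-leaves≡0 : ∀ {a i} → s (spine a) ≡ spine i → count good? (leaves i) ≡ 0
  good-leaves≡0 {a} {i} sa≡i = count-none good? {leaves i} λ v∈ good-v →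
    let (_ , v≡leaf) = ∈-tabulate⁻ v∈ in
    leaf≢spine (trans (sym v≡leaf) (s-injective (trans (good-leaf v∈ good-v) (sym sa≡i))))
    where
    leaf≢spine : ∀ {x} → leaf i x ≢ spine a
    leaf≢spine ()

  leaves≤badIn : ∀ i → count bad? (leaves i) ≤ badIn i
  leaves≤badIn i = ≤-trans (m≤n+m _ _) (≤-reflexive (sym (count-insertAfterHead bad? (spine i) (leaves i))))

  excess-leaves-bad : ∀ i → l i ∸ 1 ≤ count bad? (leaves i)
  excess-leaves-bad i = begin
    l i ∸ 1                                           ≡⟨ cong (_∸ 1) (bad-leaves+good-leaves i) ⟨
    count bad? (leaves i) + count good? (leaves i) ∸ 1 ≤⟨ ∸-monoˡ-≤ 1 (+-monoʳ-≤ (count bad? (leaves i)) (good-leaves≤1 i)) ⟩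
    count bad? (leaves i) + 1 ∸ 1                     ≡⟨ m+n∸n≡m _ 1 ⟩
    count bad? (leaves i)                             ∎
    where open ≤-Reasoning

  entered-leaves-bad : ∀ {a i} → s (spine a) ≡ spine i → count bad? (leaves i) ≡ l i
  entered-leaves-bad {a} {i} sa≡i = begin
    count bad? (leaves i)                             ≡⟨ +-identityʳ _ ⟨
    count bad? (leaves i) + 0                         ≡⟨ cong (count bad? (leaves i) +_) (good-leaves≡0 sa≡i) ⟨
    count bad? (leaves i) + count good? (leaves i)    ≡⟨ bad-leaves+good-leaves i ⟩
    l i                                               ∎
    where open ≡-Reasoning

  excess≤badIn : ∀ i → excess i ≤ badIn i
  excess≤badIn i with dichotomy i
  ... | inj₁ leafy = subst (_≤ badIn i) (sym (excess-leafy leafy)) (≤-trans (excess-leaves-bad i) (leaves≤badIn i))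
  ... | inj₂ l≡0   = subst (_≤ badIn i) (sym (excess-bare l≡0)) z≤n

  SpineArc : ℕ → ℕ → Set
  SpineArc j k = ∃₂ λ (i i' : Fin (suc m)) → toℕ i ≡ j × toℕ i' ≡ k × s (spine i) ≡ spine i'

  spineArc? : ∀ j k → Dec (SpineArc j k)
  spineArc? j k = Finₚ.any? λ i → Finₚ.any? λ i' →
    (toℕ i ℕ.≟ j) ×-dec (toℕ i' ℕ.≟ k) ×-dec (s (spine i) ≟ spine i')

  SpineArc-asym : ∀ {j k} → SpineArc j k → ¬ SpineArc k j
  SpineArc-asym (i , i' , refl , refl , si≡i') (a , a' , a≡i' , a'≡i , sa≡a')
    with Finₚ.toℕ-injective a≡i' | Finₚ.toℕ-injective a'≡i
  ... | refl | refl = s-noTwoCycles (spine i) (trans (cong s si≡i') sa≡a')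

  SpineArc-injective : ∀ {i j k} → SpineArc i k → SpineArc j k → i ≡ j
  SpineArc-injective (a , b , refl , refl , sa≡b) (a' , b' , refl , b'≡b , sa'≡b')
    with Finₚ.toℕ-injective b'≡b
  ... | refl = cong toℕ (spine-injective (s-injective (trans sa≡b (sym sa'≡b'))))

  credit : ℕ → ℕ
  credit = extend (λ i → badIn i ∸ excess i)

  credit-leafy : ∀ {j k} → k ≤ m → Leafy k → SpineArc j k → 1 ≤ credit k
  credit-leafy _ leafy (a , i , _ , refl , sa≡i) =
    subst (1 ≤_) (sym (extend-toℕ _ i)) (m+n≤o⇒m≤o∸n 1 (begin
      1 + excess i          ≡⟨ cong suc (excess-leafy (Leafy-toℕ⁻ leafy)) ⟩
      1 + (l i ∸ 1)         ≡⟨ m+[n∸m]≡n (≤-trans (s≤s z≤n) (Leafy-toℕ⁻ leafy)) ⟩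
      l i                   ≡⟨ entered-leaves-bad sa≡i ⟨
      count bad? (leaves i) ≤⟨ leaves≤badIn i ⟩
      badIn i               ∎))
    where open ≤-Reasoning

  credit-bare : ∀ {k} → suc k ≤ m → ¬ Leafy (suc k) → ¬ SpineArc (suc k) k → ¬ SpineArc (suc k) (suc (suc k)) →
                1 ≤ credit (suc k)
  credit-bare k+1≤m bare ¬left ¬right with spineAt k+1≤m
  ... | i , i≡k+1 = subst (λ t → 1 ≤ credit t) i≡k+1 (subst (1 ≤_) (sym (extend-toℕ _ i))
                      (subst (λ e → 1 ≤ badIn i ∸ e) (sym (excess-bare l≡0))
                        (count-≥1 bad? (∈-insertAfterHeadˡ (leaves i)) spine-bad)))
    where
    l≡0 : l i ≡ 0
    l≡0 = bare⇒l≡0 (subst (¬_ ∘ Leafy) (sym i≡k+1) bare)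
    spine-bad : ¬ Adj (spine i) (s (spine i))
    spine-bad adj with spine-adj adj
    ... | inj₁ (j , si≡j , inj₁ i→j) = ¬right (i , j , i≡k+1 , trans (sym i→j) (cong suc i≡k+1) , si≡j)
    ... | inj₁ (j , si≡j , inj₂ j→i) = ¬left (i , j , i≡k+1 , suc-injective (trans j→i i≡k+1) , si≡j)
    ... | inj₂ (x , _) with subst Fin l≡0 x
    ...   | ()

  open Credit m SpineArc spineArc? credit Leafy-m SpineArc-asym SpineArc-injective credit-leafy credit-bare

  lower-bound : P0 l + leafExcess l ≤ count bad? vertices
  lower-bound = begin
    P0 l + leafExcess l                                        ≡⟨ cong₂ _+_ P0≡falls leafExcess≡∑ ⟩
    ∑[ k < m ] ⟦ fall? k ⟧ + ∑< (suc m) (extend excess)        ≤⟨ +-monoˡ-≤ _ falls≤credit ⟩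
    ∑< (suc m) credit + ∑< (suc m) (extend excess)             ≡⟨ +-comm (∑< (suc m) credit) _ ⟩
    ∑< (suc m) (extend excess) + ∑< (suc m) credit             ≡⟨ ∑-distrib-+ (suc m) (extend excess) credit ⟨
    ∑[ k < suc m ] (extend excess k + credit k)                ≡⟨ ∑-cong (suc m) (λ k _ → extend-+ excess+credit≡badIn k) ⟩
    ∑< (suc m) (extend badIn)                                  ≡⟨ count-bad≡∑badIn ⟨
    count bad? vertices                                        ∎
    where
    open ≤-Reasoning
    excess+credit≡badIn : ∀ i → excess i + (badIn i ∸ excess i) ≡ badIn i
    excess+credit≡badIn i = m+[n∸m]≡n (excess≤badIn i)

module UpperBound (m : ℕ) (l : Fin (suc m) → ℕ)
  (dichotomy : ∀ i → 2 ≤ l i ⊎ l i ≡ 0) (leafy-first : 2 ≤ l zero) (leafy-last : 2 ≤ l (fromℕ m))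
  (s : Vtx (suc m) l → Vtx (suc m) l)
  (s-consecutive : ∀ {u w} → Consecutive u w (Caterpillar.vertices l) → s u ≡ w)
  where

  open Caterpillar l
  open Segments m l dichotomy leafy-last
  open Successor s

  star-bad≤ : ∀ {k} (f : Fin k → V) x → 2 ≤ k → (∀ t → Adj (f t) x) → (∀ t → Adj x (f t)) →
    (∀ {u w} → Consecutive u w (insertAfterHead x (tabulate f)) → s u ≡ w) →
    count bad? (insertAfterHead x (tabulate f)) ≤ k ∸ 1
  star-bad≤ {suc zero} f x (s≤s ()) _ _ _
  star-bad≤ {suc (suc r)} f x _ f→x x→f s-cons = begin
    count bad? (f zero ∷ x ∷ tabulate (f ∘ suc))                       ≡⟨ count-∷ bad? (f zero) _ ⟩
    ⟦ bad? (f zero) ⟧ + count bad? (x ∷ tabulate (f ∘ suc))            ≡⟨ cong₂ _+_ first-good (count-∷ bad? x _) ⟩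
    ⟦ bad? x ⟧ + count bad? (tabulate (f ∘ suc))                       ≡⟨ cong (_+ count bad? (tabulate (f ∘ suc))) centre-good ⟩
    count bad? (tabulate (f ∘ suc))                                    ≤⟨ count≤length bad? (tabulate (f ∘ suc)) ⟩
    length (tabulate (f ∘ suc))                                        ≡⟨ Listₚ.length-tabulate (f ∘ suc) ⟩
    suc r                                                              ∎
    where
    open ≤-Reasoning
    first-good : ⟦ bad? (f zero) ⟧ ≡ 0
    first-good = ⟦⟧-no (bad? (f zero)) λ ¬adj → ¬adj (subst (Adj (f zero)) (sym (s-cons here)) (f→x zero))
    centre-good : ⟦ bad? x ⟧ ≡ 0
    centre-good = ⟦⟧-no (bad? x) λ ¬adj → ¬adj (subst (Adj x) (sym (s-cons (there here))) (x→f (suc zero)))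

  group-bare : ∀ {i} → l i ≡ 0 → group i ≡ spine i ∷ []
  group-bare {i} l≡0 = cong (insertAfterHead (spine i)) (tabulate-≡[] (leaf i) l≡0)

  s-in-group : ∀ i {u w} → Consecutive u w (group i) → s u ≡ w
  s-in-group i cons = s-consecutive (Consecutive-concat (∈-map⁺ group (∈-allFin i)) cons)

  badIn-leafy : ∀ {i} → 2 ≤ l i → badIn i ≤ excess i
  badIn-leafy {i} leafy = subst (badIn i ≤_) (sym (excess-leafy leafy))
    (star-bad≤ (leaf i) (spine i) leafy lf-sp sp-lf (s-in-group i))

  badIn-bare-bare : ∀ {i i'} → suc (toℕ i) ≡ toℕ i' → l i ≡ 0 → l i' ≡ 0 → badIn i ≡ 0
  badIn-bare-bare {i} {i'} i→i' l≡0 l'≡0 with lastOrInject₁ i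
  ... | last = contradiction (trans (cong suc (sym (Finₚ.toℕ-fromℕ m))) i→i') (<⇒≢ (Finₚ.toℕ<n i') ∘ sym)
  ... | inject j with Finₚ.toℕ-injective {i = i'} {j = suc j} (trans (sym i→i') (cong suc (Finₚ.toℕ-inject₁ j)))
  ...   | refl = trans (cong (count bad?) (group-bare l≡0))
                         (count-none bad? {spine (inject₁ j) ∷ []} λ { (here refl) ¬adj → ¬adj adj })
    where
    adj : Adj (spine (inject₁ j)) (s (spine (inject₁ j)))
    adj = subst (Adj (spine (inject₁ j))) (sym (s-consecutive (Consecutive-concat-map group
            (Consecutive-tabulate (λ t → t) j) (group-bare l≡0) (group-bare l'≡0)))) (path→ i→i')

  bare⇒before-last : ∀ {i} → l i ≡ 0 → toℕ i < m
  bare⇒before-last {i} l≡0 with m≤n⇒m<n∨m≡n (toℕ≤m i)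
  ... | inj₁ i<m = i<m
  ... | inj₂ i≡m = contradiction (Leafy-toℕ⁺ (subst (2 ≤_) (cong l (sym i≡last)) leafy-last)) (l≡0⇒bare l≡0)
    where
    i≡last : i ≡ fromℕ m
    i≡last = Finₚ.toℕ-injective (trans i≡m (sym (Finₚ.toℕ-fromℕ m)))

  badIn≤ : ∀ i → badIn i ≤ excess i + ⟦ rise? (toℕ i) ⟧
  badIn≤ i with dichotomy i
  ... | inj₁ leafy = ≤-trans (badIn-leafy leafy) (m≤m+n _ _)
  ... | inj₂ l≡0   =
    subst (λ e → badIn i ≤ e + ⟦ rise? (toℕ i) ⟧) (sym (excess-bare l≡0)) (bare (leafy? (suc (toℕ i))))
    where
    bare : Dec (Leafy (suc (toℕ i))) → badIn i ≤ ⟦ rise? (toℕ i) ⟧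
    bare (yes leafy') = subst (badIn i ≤_) (sym (⟦⟧-yes (rise? (toℕ i)) (l≡0⇒bare l≡0 , leafy')))
                          (subst (λ g → count bad? g ≤ 1) (sym (group-bare l≡0)) (count≤length bad? (spine i ∷ [])))
    bare (no ¬leafy') with spineAt (bare⇒before-last l≡0)
    ... | i' , i'≡i+1 = subst (_≤ ⟦ rise? (toℕ i) ⟧) (sym (badIn-bare-bare (sym i'≡i+1) l≡0
                          (bare⇒l≡0 (subst (¬_ ∘ Leafy) (sym i'≡i+1) ¬leafy')))) z≤n

  upper-bound : count bad? vertices ≤ P0 l + leafExcess l
  upper-bound = begin
    count bad? vertices                                          ≡⟨ count-bad≡∑badIn ⟩
    ∑< (suc m) (extend badIn)                                    ≤⟨ ∑-mono-≤ (suc m) pointwise ⟩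
    ∑[ k < suc m ] (extend excess k + ⟦ rise? k ⟧)               ≡⟨ ∑-distrib-+ (suc m) (extend excess) (⟦_⟧ ∘ rise?) ⟩
    ∑< (suc m) (extend excess) + ∑[ k < suc m ] ⟦ rise? k ⟧      ≡⟨ cong₂ _+_ (sym leafExcess≡∑) rises≡P0 ⟩
    leafExcess l + P0 l                                          ≡⟨ +-comm (leafExcess l) (P0 l) ⟩
    P0 l + leafExcess l                                          ∎
    where
    open ≤-Reasoning
    pointwise : ∀ k → k < suc m → extend badIn k ≤ extend excess k + ⟦ rise? k ⟧
    pointwise k k<n with spineAt (s≤s⁻¹ k<n)
    ... | i , refl rewrite extend-toℕ badIn i | extend-toℕ excess i = badIn≤ i
    rises≡P0 : ∑[ k < suc m ] ⟦ rise? k ⟧ ≡ P0 l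
    rises≡P0 = begin-equality
      ∑[ k < m ] ⟦ rise? k ⟧ + ⟦ rise? m ⟧   ≡⟨ cong (∑< m (⟦_⟧ ∘ rise?) +_) (⟦⟧-no (rise? m) λ (bare , _) → bare Leafy-m) ⟩
      ∑[ k < m ] ⟦ rise? k ⟧ + 0             ≡⟨ +-identityʳ _ ⟩
      ∑[ k < m ] ⟦ rise? k ⟧                 ≡⟨ falls≡rises {m} (Leafy-toℕ⁺ {zero} leafy-first) Leafy-m ⟨
      ∑[ k < m ] ⟦ fall? k ⟧                 ≡⟨ P0≡falls ⟨
      P0 l                                   ∎

module Completion (m : ℕ) (l : Fin (suc m) → ℕ)
  (dichotomy : ∀ i → 2 ≤ l i ⊎ l i ≡ 0) (leafy-first : 2 ≤ l zero) (leafy-last : 2 ≤ l (fromℕ m)) where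

  open Caterpillar l

  minimal : ∀ F → ValidAddition Adj F → HasHamiltonianCycle (AddEdges Adj F) → P0 l + leafExcess l ≤ length F
  minimal F _ ham =
    let (s , s-injective , s-noTwoCycles , H-s) = hamiltonianCycle⇒successor {H = AddEdges Adj F} ham in
    ≤-trans (LowerBound.lower-bound m l dichotomy leafy-last s s-injective s-noTwoCycles)
            (count-nonEdge≤length Adj adj? F s s-injective s-noTwoCycles H-s vertices-unique)

  three≤vertices : 3 ≤ length vertices
  three≤vertices = ≤-trans (s≤s leafy-first)
    (≤-trans (≤-reflexive (trans (cong suc (sym (Listₚ.length-tabulate {n = l zero} (leaf zero))))
                                 (sym (length-insertAfterHead (leaves zero)))))
             (Listₚ.length-++-≤ˡ (group zero)))

  hamCompleteNumber : HamCompleteNumberIs (Adj {suc m} {l}) (P0 l + leafExcess l)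
  hamCompleteNumber =
    let (F₀ , valid , cycle , s , s-consecutive , |F₀|≤) =
          listing⇒completion Adj adj? vertices-unique ∈-vertices three≤vertices in
    (F₀ , valid , ≤-antisym (≤-trans |F₀|≤ (upper-bound s s-consecutive)) (minimal F₀ valid cycle) , cycle)
    , minimal
    where open UpperBound m l dichotomy leafy-first leafy-last

positive⇒leafy : ∀ {x} → 2 ≤ x ⊎ x ≡ 0 → 1 ≤ x → 2 ≤ x
positive⇒leafy (inj₁ 2≤x) _   = 2≤x
positive⇒leafy (inj₂ refl) ()

mainTheorem6 : (m : ℕ) (l : Fin (suc m) → ℕ) →
    (∀ i → 2 ≤ l i ⊎ l i ≡ 0) →
    1 ≤ l zero → 1 ≤ l (fromℕ m) →
    HamCompleteNumberIs (Adj {suc m} {l}) (P0 l + leafExcess l)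
mainTheorem6 m l dichotomy first≥1 last≥1 =
  Completion.hamCompleteNumber m l dichotomy (positive⇒leafy (dichotomy zero) first≥1)
                                             (positive⇒leafy (dichotomy (fromℕ m)) last≥1)
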